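{- Let $\mathfrak{plc}_I$ be a tropical plactic algebra with ordered generators $\{\mathfrak a_i:i\in I\}$. For any two generators $\mathfrak a,\mathfrak b$ and every $m\in\mathbb N$, $$(\mathfrak a+\mathfrak b)^m=\mathfrak a^m+\mathfrak b^m.$$
   Context: Let $I\subseteq\mathbb N$ be nonempty. A tropical plactic algebra $\mathfrak{plc}_I$ is a semiring $(\mathfrak{plc}_I,+,\cdot)$ (commutative additive monoid with zero $\mathfrak o$, multiplicative monoid with identity $\mathfrak e$, distributivity), additively idempotent, generated by a totally ordered set $\{\mathfrak a_i:i\in I\}$, and satisfying for all generators $\mathfrak a\le\mathfrak b\le\mathfrak c$: (TPA1) $\mathfrak a=\mathfrak e+\mathfrak a$; (TPA2) $\mathfrak b\mathfrak a=\mathfrak a+\mathfrak b$ if $\mathfrak b>\mathfrak a$; (TPA3) $\mathfrak a(\mathfrak b+\mathfrak c)=\mathfrak a\mathfrak b+\mathfrak c$; (TPA4) $(\mathfrak a+\mathfrak b)\mathfrak c=\mathfrak a+\mathfrak b\mathfrak c$. -}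

module Defs where

open import Level using (Level; suc; _⊔_)
open import Data.Nat using (ℕ; _≤_; _<_)
open import Data.Product using (Σ)
open import Algebra.Bundles using (Semiring)
open import Relation.Unary using (Pred; _∈_)

open Level using () renaming (zero to lz)

module Gen {c ℓ} (R : Semiring c ℓ) (I : Pred ℕ lz) (gen : (i : ℕ) → i ∈ I → Semiring.Carrier R) where
  open Semiring R
  data Generated : Carrier → Set (c ⊔ ℓ) where
    g-gen  : ∀ i (p : i ∈ I) → Generated (gen i p)
    g-zero : Generated 0#
    g-one  : Generated 1#
    g-+    : ∀ {x y} → Generated x → Generated y → Generated (x + y)
    g-*    : ∀ {x y} → Generated x → Generated y → Generated (x * y)
    g-≈    : ∀ {x y} → x ≈ y → Generated x → Generated y

module _ {c ℓ} (R : Semiring c ℓ) where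
  open Semiring R
  pow : Carrier → ℕ → Carrier
  pow x Data.Nat.zero = 1#
  pow x (Data.Nat.suc m) = x * pow x m

-- A tropical plactic algebra plc_I for a nonempty I ⊆ ℕ, with generators
-- a_i (i ∈ I) totally ordered by the order of their indices in ℕ.
record TropicalPlacticAlgebra (c ℓ : Level) (I : Pred ℕ lz) : Set (suc (c ⊔ ℓ)) where
  field
    semiring : Semiring c ℓ
  open Semiring semiring public
  field
    nonempty   : Σ ℕ (λ i → i ∈ I)
    +-idem     : ∀ x → x + x ≈ x
    gen        : (i : ℕ) → i ∈ I → Carrier
    generates  : ∀ x → Gen.Generated semiring I gen x
    TPA1 : ∀ i (p : i ∈ I) → gen i p ≈ 1# + gen i p
    TPA2 : ∀ i j (p : i ∈ I) (q : j ∈ I) → i < j →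
           gen j q * gen i p ≈ gen i p + gen j q
    TPA3 : ∀ i j k (p : i ∈ I) (q : j ∈ I) (r : k ∈ I) → i ≤ j → j ≤ k →
           gen i p * (gen j q + gen k r) ≈ gen i p * gen j q + gen k r
    TPA4 : ∀ i j k (p : i ∈ I) (q : j ∈ I) (r : k ∈ I) → i ≤ j → j ≤ k →
           (gen i p + gen j q) * gen k r ≈ gen i p + gen j q * gen k r

-- In an idempotent semiring write x ≤ y for x + y ≈ y. Every generator lies above 1, so its
-- powers increase, and any two generators satisfy ab ≤ a + b² (by TPA4 when a ≤ b, by TPA2
-- when a > b). Multiplying by b repeatedly gives a bᵐ ≤ a + bᵐ⁺¹ ≤ aᵐ⁺¹ + bᵐ⁺¹, so the cross
-- terms of (a + b)(aᵐ + bᵐ) are absorbed by aᵐ⁺¹ + bᵐ⁺¹.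
module Submission where

open import Defs
import Level
open import Algebra.Bundles using (Semiring)
open import Algebra.Definitions using (Idempotent)
open import Data.Nat using (ℕ; zero; suc; _≤?_)
import Data.Nat.Properties as ℕ
open import Relation.Binary.Bundles using (Preorder)
open import Relation.Unary using (Pred; _∈_)
open import Relation.Nullary using (yes; no)

module IdempotentSemiringOrder {c ℓ} (R : Semiring c ℓ)
  (+-idem : Idempotent (Semiring._≈_ R) (Semiring._+_ R)) where

  open Semiring R

  infix 4 _≤_
  _≤_ : Carrier → Carrier → Set ℓ
  x ≤ y = x + y ≈ y

  ≤-reflexive : ∀ {x y} → x ≈ y → x ≤ y
  ≤-reflexive {x} {y} x≈y = trans (+-congʳ x≈y) (+-idem y)

  ≤-trans : ∀ {x y z} → x ≤ y → y ≤ z → x ≤ z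
  ≤-trans {x} {y} {z} x≤y y≤z = begin
    x + z        ≈⟨ +-congˡ y≤z ⟨
    x + (y + z)  ≈⟨ +-assoc x y z ⟨
    (x + y) + z  ≈⟨ +-congʳ x≤y ⟩
    y + z        ≈⟨ y≤z ⟩
    z            ∎
    where open import Relation.Binary.Reasoning.Setoid setoid

  ≤-refl : ∀ {x} → x ≤ x
  ≤-refl = ≤-reflexive refl

  ≤-antisym : ∀ {x y} → x ≤ y → y ≤ x → x ≈ y
  ≤-antisym {x} {y} x≤y y≤x = trans (sym y≤x) (trans (+-comm y x) x≤y)

  ≤-preorder : Preorder c ℓ ℓ
  ≤-preorder = record
    { _≲_ = _≤_
    ; isPreorder = record
      { isEquivalence = isEquivalence
      ; reflexive = ≤-reflexive
      ; trans = ≤-trans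
      }
    }

  x≤x+y : ∀ x y → x ≤ x + y
  x≤x+y x y = trans (sym (+-assoc x x y)) (+-congʳ (+-idem x))

  y≤x+y : ∀ x y → y ≤ x + y
  y≤x+y x y = ≤-trans (x≤x+y y x) (≤-reflexive (+-comm y x))

  +-lub : ∀ {x y z} → x ≤ z → y ≤ z → x + y ≤ z
  +-lub {x} {y} {z} x≤z y≤z = trans (+-assoc x y z) (trans (+-congˡ y≤z) x≤z)

  +-mono-≤ : ∀ {x x′ y y′} → x ≤ x′ → y ≤ y′ → x + y ≤ x′ + y′
  +-mono-≤ {x′ = x′} {y′ = y′} x≤x′ y≤y′ =
    +-lub (≤-trans x≤x′ (x≤x+y x′ y′)) (≤-trans y≤y′ (y≤x+y x′ y′))

  *-monoˡ-≤ : ∀ z {x y} → x ≤ y → z * x ≤ z * y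
  *-monoˡ-≤ z {x} {y} x≤y = trans (sym (distribˡ z x y)) (*-congˡ x≤y)

  *-monoʳ-≤ : ∀ z {x y} → x ≤ y → x * z ≤ y * z
  *-monoʳ-≤ z {x} {y} x≤y = trans (sym (distribʳ z x y)) (*-congʳ x≤y)

  *-mono-≤ : ∀ {x x′ y y′} → x ≤ x′ → y ≤ y′ → x * y ≤ x′ * y′
  *-mono-≤ {x′ = x′} {y = y} x≤x′ y≤y′ = ≤-trans (*-monoʳ-≤ y x≤x′) (*-monoˡ-≤ x′ y≤y′)

  1≤y⇒x≤y*x : ∀ {y} → 1# ≤ y → ∀ x → x ≤ y * x
  1≤y⇒x≤y*x 1≤y x = ≤-trans (≤-reflexive (sym (*-identityˡ x))) (*-monoʳ-≤ x 1≤y)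

  open import Relation.Binary.Reasoning.Preorder ≤-preorder

  x≤x^[m+1] : ∀ {x} → 1# ≤ x → ∀ m → x ≤ pow R x (suc m)
  x≤x^[m+1] {x} 1≤x zero    = ≤-reflexive (sym (*-identityʳ x))
  x≤x^[m+1] {x} 1≤x (suc m) = ≤-trans (x≤x^[m+1] 1≤x m) (1≤y⇒x≤y*x 1≤x (pow R x (suc m)))

  x*y^m≤x+y^[m+1] : ∀ {x y} → 1# ≤ y → x * y ≤ x + y * y →
                    ∀ m → x * pow R y m ≤ x + pow R y (suc m)
  x*y^m≤x+y^[m+1] {x} {y} 1≤y xy≤x+yy zero =
    ≤-trans (≤-reflexive (*-identityʳ x)) (x≤x+y x (y * 1#))
  x*y^m≤x+y^[m+1] {x} {y} 1≤y xy≤x+yy (suc m) = begin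
    x * (y * yᵐ)                 ≈⟨ *-assoc x y yᵐ ⟨
    (x * y) * yᵐ                 ∼⟨ *-monoʳ-≤ yᵐ xy≤x+yy ⟩
    (x + y * y) * yᵐ             ≈⟨ distribʳ yᵐ x (y * y) ⟩
    x * yᵐ + (y * y) * yᵐ        ∼⟨ +-mono-≤ (x*y^m≤x+y^[m+1] 1≤y xy≤x+yy m)
                                              (≤-reflexive (*-assoc y y yᵐ)) ⟩
    (x + y * yᵐ) + y * (y * yᵐ)  ≈⟨ +-assoc x (y * yᵐ) (y * (y * yᵐ)) ⟩
    x + (y * yᵐ + y * (y * yᵐ))  ≈⟨ +-congˡ (1≤y⇒x≤y*x 1≤y (y * yᵐ)) ⟩
    x + y * (y * yᵐ)             ∎
    where yᵐ = pow R y m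

  x*y^m≤x^[m+1]+y^[m+1] : ∀ {x y} → 1# ≤ x → 1# ≤ y → x * y ≤ x + y * y →
                          ∀ m → x * pow R y m ≤ pow R x (suc m) + pow R y (suc m)
  x*y^m≤x^[m+1]+y^[m+1] 1≤x 1≤y xy≤x+yy m =
    ≤-trans (x*y^m≤x+y^[m+1] 1≤y xy≤x+yy m) (+-mono-≤ (x≤x^[m+1] 1≤x m) ≤-refl)

  pow-+ : ∀ {x y} → 1# ≤ x → 1# ≤ y → x * y ≤ x + y * y → y * x ≤ y + x * x →
          ∀ m → pow R (x + y) m ≈ pow R x m + pow R y m
  pow-+ 1≤x 1≤y xy≤x+yy yx≤y+xx zero = sym (+-idem 1#)
  pow-+ {x} {y} 1≤x 1≤y xy≤x+yy yx≤y+xx (suc m) =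
    trans (*-congˡ (pow-+ 1≤x 1≤y xy≤x+yy yx≤y+xx m)) (≤-antisym expand absorb)
    where
    xᵐ = pow R x m
    yᵐ = pow R y m
    xᵐ⁺¹ = pow R x (suc m)
    yᵐ⁺¹ = pow R y (suc m)

    expand : (x + y) * (xᵐ + yᵐ) ≤ xᵐ⁺¹ + yᵐ⁺¹
    expand = begin
      (x + y) * (xᵐ + yᵐ)                       ≈⟨ distribʳ (xᵐ + yᵐ) x y ⟩
      x * (xᵐ + yᵐ) + y * (xᵐ + yᵐ)             ≈⟨ +-cong (distribˡ x xᵐ yᵐ) (distribˡ y xᵐ yᵐ) ⟩
      (xᵐ⁺¹ + x * yᵐ) + (y * xᵐ + yᵐ⁺¹)         ∼⟨ +-lub (+-lub (x≤x+y xᵐ⁺¹ yᵐ⁺¹) x*yᵐ≤)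
                                                         (+-lub y*xᵐ≤ (y≤x+y xᵐ⁺¹ yᵐ⁺¹)) ⟩
      xᵐ⁺¹ + yᵐ⁺¹                               ∎
      where
      x*yᵐ≤ : x * yᵐ ≤ xᵐ⁺¹ + yᵐ⁺¹
      x*yᵐ≤ = x*y^m≤x^[m+1]+y^[m+1] 1≤x 1≤y xy≤x+yy m
      y*xᵐ≤ : y * xᵐ ≤ xᵐ⁺¹ + yᵐ⁺¹
      y*xᵐ≤ = ≤-trans (x*y^m≤x^[m+1]+y^[m+1] 1≤y 1≤x yx≤y+xx m) (≤-reflexive (+-comm yᵐ⁺¹ xᵐ⁺¹))

    absorb : xᵐ⁺¹ + yᵐ⁺¹ ≤ (x + y) * (xᵐ + yᵐ)
    absorb = +-lub (*-mono-≤ (x≤x+y x y) (x≤x+y xᵐ yᵐ)) (*-mono-≤ (y≤x+y x y) (y≤x+y xᵐ yᵐ))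

module TropicalPlacticAlgebraProperties {c ℓ} {I : Pred ℕ Level.zero}
  (A : TropicalPlacticAlgebra c ℓ I) where

  open TropicalPlacticAlgebra A
  open IdempotentSemiringOrder semiring +-idem public
  open import Relation.Binary.Reasoning.Preorder ≤-preorder

  1≤gen : ∀ i (p : i ∈ I) → 1# ≤ gen i p
  1≤gen i p = sym (TPA1 i p)

  module _ i j (p : i ∈ I) (q : j ∈ I) where
    private
      a = gen i p
      b = gen j q

    gen*gen≤gen+gen*gen : a * b ≤ a + b * b
    gen*gen≤gen+gen*gen with i ≤? j
    ... | yes i≤j = begin
      a * b        ∼⟨ *-monoʳ-≤ b (x≤x+y a b) ⟩
      (a + b) * b  ≈⟨ TPA4 i j j p q q i≤j ℕ.≤-refl ⟩
      a + b * b    ∎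
    ... | no i≰j = begin
      a * b        ≈⟨ TPA2 j i q p (ℕ.≰⇒> i≰j) ⟩
      b + a        ≈⟨ +-comm b a ⟩
      a + b        ∼⟨ +-mono-≤ ≤-refl (1≤y⇒x≤y*x (1≤gen j q) b) ⟩
      a + b * b    ∎

lemma2p15 : ∀ {c ℓ} {I : Pred ℕ Level.zero} (A : TropicalPlacticAlgebra c ℓ I) →
    let open TropicalPlacticAlgebra A in
    ∀ i j (p : i ∈ I) (q : j ∈ I) (m : ℕ) →
    pow semiring (gen i p + gen j q) m ≈ pow semiring (gen i p) m + pow semiring (gen j q) m
lemma2p15 A i j p q =
  pow-+ (1≤gen i p) (1≤gen j q) (gen*gen≤gen+gen*gen i j p q) (gen*gen≤gen+gen*gen j i q p)
  where open TropicalPlacticAlgebraProperties A
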